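{- Let $G$ be a finite simple graph with a perfect matching and maximum degree $\Delta(G)$. Then $gf(G)-Af(G)\geq (2-\Delta(G))F(G)$.
   Context: For a perfect matching $M$ of $G$: $f(G,M)$ is the minimum size of a subset $S\subseteq M$ contained in no perfect matching of $G$ other than $M$, and $F(G)=\max_M f(G,M)$. An anti-forcing set of $M$ is a subset $S\subseteq E(G)\setminus M$ such that $G-S$ (delete the edges of $S$) has a unique perfect matching; $af(G,M)$ is the minimum size of an anti-forcing set of $M$, and $Af(G)=\max_M af(G,M)$ over all perfect matchings $M$. A global forcing set of $G$ is an edge subset $S$ such that no two distinct perfect matchings $M_1,M_2$ of $G$ satisfy $M_1\cap S=M_2\cap S$; $gf(G)$ is the minimum size of a global forcing set. -}

module Defs where

open import Data.Nat using (ℕ; zero; suc; _+_; _≤_; _<_; _⊔_)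
open import Data.Bool using (Bool; true; false; _∧_; if_then_else_)
open import Data.Fin using (Fin; toℕ)
open import Data.List using (List; allFin; map; foldr)
open import Data.Nat.ListAction using (sum)
open import Data.Product using (Σ; ∃; ∃-syntax; _×_; _,_)
open import Relation.Binary.PropositionalEquality using (_≡_)
open import Relation.Nullary using (¬_)
open import Relation.Nullary.Decidable using (⌊_⌋)
open import Data.Nat using (_<?_)

record Graph (n : ℕ) : Set where
  field
    adj    : Fin n → Fin n → Bool
    sym    : ∀ i j → adj i j ≡ adj j i
    irrefl : ∀ i → adj i i ≡ false
open Graph public

-- A set of (unordered) pairs of vertices, encoded as a symmetric Boolean matrix.
EdgeSet : ℕ → Set
EdgeSet n = Fin n → Fin n → Bool

IsEdgeSet : ∀ {n} → Graph n → EdgeSet n → Set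
IsEdgeSet G S = (∀ i j → S i j ≡ S j i) × (∀ i j → S i j ≡ true → adj G i j ≡ true)

_≈E_ : ∀ {n} → EdgeSet n → EdgeSet n → Set
S ≈E T = ∀ i j → S i j ≡ T i j

_⊆E_ : ∀ {n} → EdgeSet n → EdgeSet n → Set
S ⊆E T = ∀ i j → S i j ≡ true → T i j ≡ true

Disjoint : ∀ {n} → EdgeSet n → EdgeSet n → Set
Disjoint S T = ∀ i j → S i j ∧ T i j ≡ false

size : ∀ {n} → EdgeSet n → ℕ
size {n} S = sum (map (λ i → sum (map (λ j →
  if ⌊ toℕ i <? toℕ j ⌋ ∧ S i j then 1 else 0) (allFin n))) (allFin n))

IsPM : ∀ {n} → Graph n → EdgeSet n → Set
IsPM {n} G M = IsEdgeSet G M ×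
  (∀ i → ∃[ j ] (M i j ≡ true × (∀ k → M i k ≡ true → k ≡ j)))

HasPM : ∀ {n} → Graph n → Set
HasPM G = ∃[ M ] IsPM G M

IsMin : (ℕ → Set) → ℕ → Set
IsMin P k = P k × (∀ m → P m → k ≤ m)

IsMax : (ℕ → Set) → ℕ → Set
IsMax P k = P k × (∀ m → P m → m ≤ k)

IsForcingSet : ∀ {n} → Graph n → EdgeSet n → EdgeSet n → Set
IsForcingSet G M S = IsEdgeSet G S × S ⊆E M ×
  (∀ M' → IsPM G M' → S ⊆E M' → M' ≈E M)

IsForcingNumber : ∀ {n} → Graph n → EdgeSet n → ℕ → Set
IsForcingNumber G M = IsMin (λ m → ∃[ S ] (IsForcingSet G M S × size S ≡ m))

IsMaxForcingNumber : ∀ {n} → Graph n → ℕ → Set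
IsMaxForcingNumber G = IsMax (λ m → ∃[ M ] (IsPM G M × IsForcingNumber G M m))

-- S ⊆ E(G) \ M is an anti-forcing set of M: G - S has a unique perfect matching
-- (which is then M, as M avoids S). Perfect matchings of G - S are exactly the
-- perfect matchings of G disjoint from S.
IsAntiForcingSet : ∀ {n} → Graph n → EdgeSet n → EdgeSet n → Set
IsAntiForcingSet G M S = IsEdgeSet G S × Disjoint S M ×
  (∀ M' → IsPM G M' → Disjoint S M' → M' ≈E M)

IsAntiForcingNumber : ∀ {n} → Graph n → EdgeSet n → ℕ → Set
IsAntiForcingNumber G M = IsMin (λ m → ∃[ S ] (IsAntiForcingSet G M S × size S ≡ m))

IsMaxAntiForcingNumber : ∀ {n} → Graph n → ℕ → Set
IsMaxAntiForcingNumber G = IsMax (λ m → ∃[ M ] (IsPM G M × IsAntiForcingNumber G M m))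

IsGlobalForcingSet : ∀ {n} → Graph n → EdgeSet n → Set
IsGlobalForcingSet G S = IsEdgeSet G S ×
  (∀ M₁ M₂ → IsPM G M₁ → IsPM G M₂ →
     (∀ i j → S i j ∧ M₁ i j ≡ S i j ∧ M₂ i j) → M₁ ≈E M₂)

IsGlobalForcingNumber : ∀ {n} → Graph n → ℕ → Set
IsGlobalForcingNumber G = IsMin (λ m → ∃[ S ] (IsGlobalForcingSet G S × size S ≡ m))

degree : ∀ {n} → Graph n → Fin n → ℕ
degree {n} G i = sum (map (λ j → if adj G i j then 1 else 0) (allFin n))

maxDegree : ∀ {n} → Graph n → ℕ
maxDegree {n} G = foldr _⊔_ 0 (map (degree G) (allFin n))

-- Let S be a minimum global forcing set and W the set of smaller endpoints of its edges,
-- so |W| ≤ gf(G) and every edge of S meets W.  If a perfect matching M' contains the edges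
-- of a perfect matching M at the vertices of W, then M' agrees with M at every vertex of W,
-- hence on S, hence M' = M: these at most |W| edges force M, so F(G) ≤ gf(G).  Dually, let
-- M attain Af(G), let T be a minimum forcing set of M and W the smaller endpoints of T.
-- Deleting the at most (Δ - 1)|W| edges outside M at W, every remaining perfect matching
-- must use the M-edges at W, so it contains T and equals M: Af(G) ≤ (Δ - 1) f(G,M)
-- ≤ (Δ - 1) F(G).  Hence gf - Af ≥ F - (Δ - 1) F = (2 - Δ) F.
module Submission where

open import Defs hiding (sym)
open import Data.Nat using (ℕ)
open import Data.Integer using (ℤ; +_; _-_; _*_; _≥_)

import Data.Nat.Properties as ℕ

open import Algebra.Properties.Semiring.Sum ℕ.+-*-semiring
  using (sum; sum-syntax; sum-cong-≗; sum-remove; sum-replicate-zero; ∑-distrib-+; ∑-comm;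
         *-distribˡ-sum; *-distribʳ-sum)
open import Data.Bool using (Bool; true; false; _∧_; _∨_; not; if_then_else_)
open import Data.Bool.Properties using (∧-zeroʳ; ∨-comm)
open import Data.Empty using (⊥-elim)
open import Data.Fin using (Fin; zero; suc; toℕ)
open import Data.Fin.Properties using (toℕ-injective; punchInᵢ≢i)
import Data.Integer as ℤ
import Data.Integer.Properties as ℤ
open import Data.Integer.Solver using (module +-*-Solver)
open import Data.List using (allFin; map; tabulate; foldr)
open import Data.List.Properties using (map-tabulate)
open import Data.Nat using (zero; suc; _+_; _≤_; _<_; _∸_; _⊔_; _<?_; _≤?_; z≤n) renaming (_*_ to _·_)
import Data.Nat.ListAction as List
open import Data.Nat.Induction using (<-rec)
open import Data.Product using (∃; _,_; proj₁)
open import Data.Sum using (_⊎_; inj₁; inj₂)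
open import Data.Vec.Functional using (Vector; removeAt)
open import Function using (id; _∘_)
open import Relation.Binary.PropositionalEquality
open import Relation.Nullary using (¬_; yes; no)
open import Relation.Nullary.Decidable using (⌊_⌋; decidable-stable)

private
  variable
    n : ℕ

true≢false : true ≢ false
true≢false ()

𝟙 : Bool → ℕ
𝟙 b = if b then 1 else 0

𝟙-mono : ∀ {a b} → (a ≡ true → b ≡ true) → 𝟙 a ≤ 𝟙 b
𝟙-mono {false} _ = z≤n
𝟙-mono {true} a⇒b rewrite a⇒b refl = ℕ.≤-refl

𝟙-∧ : ∀ a b → 𝟙 (a ∧ b) ≡ 𝟙 a · 𝟙 b
𝟙-∧ true b = sym (ℕ.+-identityʳ (𝟙 b))
𝟙-∧ false b = refl

𝟙-∧-∨ : ∀ a b c → 𝟙 (a ∧ (b ∨ c)) ≤ 𝟙 (a ∧ b) + 𝟙 (a ∧ c)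
𝟙-∧-∨ false b c = z≤n
𝟙-∧-∨ true true c = ℕ.m≤m+n 1 _
𝟙-∧-∨ true false c = ℕ.≤-refl

∧-trueˡ : ∀ {a b} → a ∧ b ≡ true → a ≡ true
∧-trueˡ {true} _ = refl

m+m≤n+n⇒m≤n : ∀ {m n} → m + m ≤ n + n → m ≤ n
m+m≤n+n⇒m≤n {m} {n} m+m≤n+n with m ≤? n
... | yes m≤n = m≤n
... | no m≰n = ⊥-elim (ℕ.<⇒≱ (ℕ.+-mono-< (ℕ.≰⇒> m≰n) (ℕ.≰⇒> m≰n)) m+m≤n+n)

∑-mono-≤ : {f g : Vector ℕ n} → (∀ i → f i ≤ g i) → ∑[ i < n ] f i ≤ ∑[ i < n ] g i
∑-mono-≤ {zero} _ = z≤n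
∑-mono-≤ {suc n} f≤g = ℕ.+-mono-≤ (f≤g zero) (∑-mono-≤ (f≤g ∘ suc))

term≤∑ : (f : Vector ℕ n) (i : Fin n) → f i ≤ ∑[ j < n ] f j
term≤∑ {suc n} f i = ℕ.≤-trans (ℕ.m≤m+n (f i) _) (ℕ.≤-reflexive (sym (sum-remove {i = i} f)))

∑-single : (f : Vector ℕ n) (k : Fin n) → (∀ j → j ≢ k → f j ≡ 0) → ∑[ j < n ] f j ≡ f k
∑-single {suc n} f k f≡0 = begin
  sum f                        ≡⟨ sum-remove {i = k} f ⟩
  f k + sum (removeAt f k)     ≡⟨ cong₂ _+_ refl (sum-cong-≗ (λ j → f≡0 _ (punchInᵢ≢i k j))) ⟩
  f k + ∑[ j < n ] 0           ≡⟨ cong₂ _+_ refl (sum-replicate-zero n) ⟩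
  f k + 0                      ≡⟨ ℕ.+-identityʳ (f k) ⟩
  f k                          ∎
  where open ≡-Reasoning

listSum-allFin : (f : Fin n → ℕ) → List.sum (map f (allFin n)) ≡ ∑[ i < n ] f i
listSum-allFin f = trans (cong List.sum (map-tabulate id f)) (listSum-tabulate f)
  where
  listSum-tabulate : ∀ {n} (f : Fin n → ℕ) → List.sum (tabulate f) ≡ sum f
  listSum-tabulate {zero} f = refl
  listSum-tabulate {suc n} f = cong₂ _+_ refl (listSum-tabulate (f ∘ suc))

-- Counting edges

_<ᵇ_ : Fin n → Fin n → Bool
i <ᵇ j = ⌊ toℕ i <? toℕ j ⌋

<ᵇ-trichotomy : (i j : Fin n) → i <ᵇ j ≡ true ⊎ j <ᵇ i ≡ true ⊎ i ≡ j
<ᵇ-trichotomy i j with toℕ i <? toℕ j | toℕ j <? toℕ i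
... | yes _ | _     = inj₁ refl
... | no _  | yes _ = inj₂ (inj₁ refl)
... | no i≮j | no j≮i = inj₂ (inj₂ (toℕ-injective (ℕ.≤-antisym (ℕ.≮⇒≥ j≮i) (ℕ.≮⇒≥ i≮j))))

𝟙-<ᵇ-pair : (i j : Fin n) (b : Bool) → 𝟙 (i <ᵇ j ∧ b) + 𝟙 (j <ᵇ i ∧ b) ≤ 𝟙 b
𝟙-<ᵇ-pair i j false rewrite ∧-zeroʳ (i <ᵇ j) | ∧-zeroʳ (j <ᵇ i) = z≤n
𝟙-<ᵇ-pair i j true with toℕ i <? toℕ j | toℕ j <? toℕ i
... | yes i<j | yes j<i = ⊥-elim (ℕ.<-asym i<j j<i)
... | yes _   | no _    = ℕ.≤-refl
... | no _    | yes _   = ℕ.≤-refl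
... | no _    | no _    = z≤n

upDegree : EdgeSet n → Fin n → ℕ
upDegree {n} S i = ∑[ j < n ] 𝟙 (i <ᵇ j ∧ S i j)

size-∑ : (S : EdgeSet n) → size S ≡ ∑[ i < n ] upDegree S i
size-∑ {n} S = trans (listSum-allFin rowSize) (sum-cong-≗ (λ i → listSum-allFin (λ j → 𝟙 (i <ᵇ j ∧ S i j))))
  where
  rowSize : Fin n → ℕ
  rowSize i = List.sum (map (λ j → 𝟙 (i <ᵇ j ∧ S i j)) (allFin n))

Symmetric : EdgeSet n → Set
Symmetric S = ∀ i j → S i j ≡ S j i

degreeIn : EdgeSet n → Fin n → ℕ
degreeIn {n} S i = ∑[ j < n ] 𝟙 (S i j)

volume : EdgeSet n → ℕ
volume {n} S = ∑[ i < n ] degreeIn S i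

size+size≤volume : (S : EdgeSet n) → Symmetric S → size S + size S ≤ volume S
size+size≤volume {n} S S-sym = begin
  size S + size S
    ≡⟨ cong₂ _+_ (size-∑ S) (trans (size-∑ S) (∑-comm below)) ⟩
  ∑[ i < n ] ∑[ j < n ] below i j + ∑[ i < n ] ∑[ j < n ] below j i
    ≡⟨ cong₂ _+_ refl (sum-cong-≗ (λ i → sum-cong-≗ (λ j → cong (λ b → 𝟙 (j <ᵇ i ∧ b)) (S-sym j i)))) ⟩
  ∑[ i < n ] ∑[ j < n ] below i j + ∑[ i < n ] ∑[ j < n ] above i j
    ≡⟨ sym (∑-distrib-+ (λ i → ∑[ j < n ] below i j) (λ i → ∑[ j < n ] above i j)) ⟩
  ∑[ i < n ] (∑[ j < n ] below i j + ∑[ j < n ] above i j)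
    ≡⟨ sum-cong-≗ (λ i → sym (∑-distrib-+ (below i) (above i))) ⟩
  ∑[ i < n ] ∑[ j < n ] (below i j + above i j)
    ≤⟨ ∑-mono-≤ (λ i → ∑-mono-≤ (λ j → 𝟙-<ᵇ-pair i j (S i j))) ⟩
  volume S ∎
  where
  open ℕ.≤-Reasoning
  below above : Fin n → Fin n → ℕ
  below i j = 𝟙 (i <ᵇ j ∧ S i j)
  above i j = 𝟙 (j <ᵇ i ∧ S i j)

volume-mono : {S T : EdgeSet n} → S ⊆E T → volume S ≤ volume T
volume-mono S⊆T = ∑-mono-≤ (λ i → ∑-mono-≤ (λ j → 𝟙-mono (S⊆T i j)))

touching : EdgeSet n → (Fin n → Bool) → EdgeSet n
touching E W i j = E i j ∧ (W i ∨ W j)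

touching-symmetric : {E : EdgeSet n} (W : Fin n → Bool) → Symmetric E → Symmetric (touching E W)
touching-symmetric W E-sym i j = cong₂ _∧_ (E-sym i j) (∨-comm (W i) (W j))

degreeSum : EdgeSet n → (Fin n → Bool) → ℕ
degreeSum {n} E W = ∑[ i < n ] (degreeIn E i · 𝟙 (W i))

count : (Fin n → Bool) → ℕ
count {n} W = ∑[ i < n ] 𝟙 (W i)

volume-touching : (E : EdgeSet n) (W : Fin n → Bool) → Symmetric E →
  volume (touching E W) ≤ degreeSum E W + degreeSum E W
volume-touching {n} E W E-sym = begin
  volume (touching E W)
    ≤⟨ ∑-mono-≤ (λ i → ∑-mono-≤ (λ j → 𝟙-∧-∨ (E i j) (W i) (W j))) ⟩
  ∑[ i < n ] ∑[ j < n ] (atSource i j + atTarget i j)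
    ≡⟨ sum-cong-≗ (λ i → ∑-distrib-+ (atSource i) (atTarget i)) ⟩
  ∑[ i < n ] (∑[ j < n ] atSource i j + ∑[ j < n ] atTarget i j)
    ≡⟨ ∑-distrib-+ (λ i → ∑[ j < n ] atSource i j) (λ i → ∑[ j < n ] atTarget i j) ⟩
  ∑[ i < n ] ∑[ j < n ] atSource i j + ∑[ i < n ] ∑[ j < n ] atTarget i j
    ≡⟨ cong₂ _+_ refl (trans (∑-comm atTarget)
         (sum-cong-≗ (λ j → sum-cong-≗ (λ i → cong (λ b → 𝟙 (b ∧ W j)) (E-sym i j))))) ⟩
  ∑[ i < n ] ∑[ j < n ] atSource i j + ∑[ i < n ] ∑[ j < n ] atSource i j
    ≡⟨ cong₂ _+_ rows≡ rows≡ ⟩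
  degreeSum E W + degreeSum E W ∎
  where
  open ℕ.≤-Reasoning
  atSource atTarget : Fin n → Fin n → ℕ
  atSource i j = 𝟙 (E i j ∧ W i)
  atTarget i j = 𝟙 (E i j ∧ W j)
  rows≡ : ∑[ i < n ] ∑[ j < n ] atSource i j ≡ degreeSum E W
  rows≡ = sum-cong-≗ (λ i → trans (sum-cong-≗ (λ j → 𝟙-∧ (E i j) (W i)))
                                  (sym (*-distribʳ-sum (𝟙 (W i)) (λ j → 𝟙 (E i j)))))

size-touching≤ : (E : EdgeSet n) (W : Fin n → Bool) {d : ℕ} → Symmetric E →
  (∀ i → degreeIn E i ≤ d) → size (touching E W) ≤ d · count W
size-touching≤ {n} E W {d} E-sym deg≤d = m+m≤n+n⇒m≤n (begin
  size T + size T                ≤⟨ size+size≤volume T (touching-symmetric W E-sym) ⟩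
  volume T                       ≤⟨ volume-touching E W E-sym ⟩
  degreeSum E W + degreeSum E W  ≤⟨ ℕ.+-mono-≤ B≤ B≤ ⟩
  d · count W + d · count W      ∎)
  where
  open ℕ.≤-Reasoning
  T : EdgeSet n
  T = touching E W
  B≤ : degreeSum E W ≤ d · count W
  B≤ = ℕ.≤-trans (∑-mono-≤ (λ i → ℕ.*-monoˡ-≤ (𝟙 (W i)) (deg≤d i)))
                 (ℕ.≤-reflexive (sym (*-distribˡ-sum d (λ i → 𝟙 (W i)))))

_∖_ : EdgeSet n → EdgeSet n → EdgeSet n
(S ∖ T) i j = S i j ∧ not (T i j)

𝟙-∖ : ∀ {a b} → (b ≡ true → a ≡ true) → 𝟙 (a ∧ not b) + 𝟙 b ≡ 𝟙 a
𝟙-∖ {true}  {true}  _ = refl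
𝟙-∖ {true}  {false} _ = refl
𝟙-∖ {false} {false} _ = refl
𝟙-∖ {false} {true} b⇒a with b⇒a refl
... | ()

≤-foldr-⊔-tabulate : (f : Fin n → ℕ) (i : Fin n) → f i ≤ foldr _⊔_ 0 (tabulate f)
≤-foldr-⊔-tabulate f zero = ℕ.m≤m⊔n _ _
≤-foldr-⊔-tabulate f (suc i) = ℕ.≤-trans (≤-foldr-⊔-tabulate (f ∘ suc) i) (ℕ.m≤n⊔m (f zero) _)

leftEnds : EdgeSet n → Fin n → Bool
leftEnds S i = ⌊ 1 ≤? upDegree S i ⌋

count-leftEnds≤size : (S : EdgeSet n) → count (leftEnds S) ≤ size S
count-leftEnds≤size S = ℕ.≤-trans (∑-mono-≤ 𝟙-leftEnds≤upDegree) (ℕ.≤-reflexive (sym (size-∑ S)))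
  where
  𝟙-leftEnds≤upDegree : ∀ i → 𝟙 (leftEnds S i) ≤ upDegree S i
  𝟙-leftEnds≤upDegree i with 1 ≤? upDegree S i
  ... | yes 1≤d = 1≤d
  ... | no _    = z≤n

leftEnds-true : (S : EdgeSet n) {i j : Fin n} → i <ᵇ j ≡ true → S i j ≡ true → leftEnds S i ≡ true
leftEnds-true S {i} {j} i<j Sij with 1 ≤? upDegree S i
... | yes _  = refl
... | no 1≰d = ⊥-elim (1≰d (subst (_≤ upDegree S i) (cong 𝟙 (cong₂ _∧_ i<j Sij))
                                  (term≤∑ (λ k → 𝟙 (i <ᵇ k ∧ S i k)) j)))

AgreeAt : EdgeSet n → EdgeSet n → Fin n → Set
AgreeAt M M' i = ∀ j → M i j ≡ M' i j

Covers : (Fin n → Bool) → EdgeSet n → Set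
Covers W S = ∀ i j → S i j ≡ true → W i ≡ true ⊎ W j ≡ true

-- Perfect matchings and forcing

module _ (G : Graph n) where

  partner-unique : {M : EdgeSet n} → IsPM G M →
    ∀ {i j k} → M i j ≡ true → M i k ≡ true → j ≡ k
  partner-unique (_ , partner) {i} Mij Mik with partner i
  ... | _ , _ , unique = trans (unique _ Mij) (sym (unique _ Mik))

  degreeIn-pm : {M : EdgeSet n} → IsPM G M → ∀ i → degreeIn M i ≡ 1
  degreeIn-pm {M = M} (_ , partner) i with partner i
  ... | k , Mik , unique = trans (∑-single (λ j → 𝟙 (M i j)) k unmatched) (cong 𝟙 Mik)
    where
    unmatched : ∀ j → j ≢ k → 𝟙 (M i j) ≡ 0
    unmatched j j≢k with M i j in Mij
    ... | true  = ⊥-elim (j≢k (unique j Mij))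
    ... | false = refl

  degree≤maxDegree : (i : Fin n) → degree G i ≤ maxDegree G
  degree≤maxDegree i = subst (degree G i ≤_) (cong (foldr _⊔_ 0) (sym (map-tabulate id (degree G))))
    (≤-foldr-⊔-tabulate (degree G) i)

  degreeIn-adj : (i : Fin n) → degreeIn (adj G) i ≡ degree G i
  degreeIn-adj i = sym (listSum-allFin (λ j → 𝟙 (adj G i j)))

  degreeIn-∖-pm : {M : EdgeSet n} → IsPM G M → ∀ i → degreeIn (adj G ∖ M) i ≤ maxDegree G ∸ 1
  degreeIn-∖-pm {M} M-pm@((_ , M⊆G) , _) i = ℕ.m+n≤o⇒m≤o∸n _ (begin
    degreeIn (adj G ∖ M) i + 1
      ≡⟨ cong₂ _+_ refl (sym (degreeIn-pm M-pm i)) ⟩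
    degreeIn (adj G ∖ M) i + degreeIn M i
      ≡⟨ sym (∑-distrib-+ (λ j → 𝟙 ((adj G ∖ M) i j)) (λ j → 𝟙 (M i j))) ⟩
    ∑[ j < n ] (𝟙 ((adj G ∖ M) i j) + 𝟙 (M i j))
      ≡⟨ sum-cong-≗ (λ j → 𝟙-∖ (M⊆G i j)) ⟩
    degreeIn (adj G) i
      ≡⟨ degreeIn-adj i ⟩
    degree G i
      ≤⟨ degree≤maxDegree i ⟩
    maxDegree G ∎)
    where open ℕ.≤-Reasoning

  maxDegree≡0⇒size≡0 : {S : EdgeSet n} → IsEdgeSet G S → maxDegree G ≡ 0 → size S ≡ 0
  maxDegree≡0⇒size≡0 {S} (S-sym , S⊆G) Δ≡0 = ℕ.n≤0⇒n≡0 (begin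
    size S                   ≤⟨ ℕ.m≤m+n (size S) (size S) ⟩
    size S + size S          ≤⟨ size+size≤volume S S-sym ⟩
    volume S                 ≤⟨ volume-mono S⊆G ⟩
    volume (adj G)           ≤⟨ ∑-mono-≤ (λ i → subst (degreeIn (adj G) i ≤_) Δ≡0 (degree≤Δ i)) ⟩
    ∑[ i < n ] 0             ≡⟨ sum-replicate-zero n ⟩
    0                        ∎)
    where
    open ℕ.≤-Reasoning
    degree≤Δ : ∀ i → degreeIn (adj G) i ≤ maxDegree G
    degree≤Δ i = subst (_≤ maxDegree G) (sym (degreeIn-adj i)) (degree≤maxDegree i)

  agreeAt-sharedEdge : {M M' : EdgeSet n} → IsPM G M → IsPM G M' →
    ∀ {i k} → M i k ≡ true → M' i k ≡ true → AgreeAt M M' i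
  agreeAt-sharedEdge {M} {M'} M-pm M'-pm {i} {k} Mik M'ik j with M i j in Mij | M' i j in M'ij
  ... | true  | true  = refl
  ... | false | false = refl
  ... | true  | false = ⊥-elim (true≢false (trans (sym M'ik)
                          (trans (cong (M' i) (partner-unique M-pm Mik Mij)) M'ij)))
  ... | false | true  = ⊥-elim (true≢false (trans (sym Mik)
                          (trans (cong (M i) (partner-unique M'-pm M'ik M'ij)) Mij)))

  agree-on-covered : {M M' S : EdgeSet n} {W : Fin n → Bool} → IsPM G M → IsPM G M' →
    Covers W S → (∀ i → W i ≡ true → AgreeAt M M' i) → ∀ i j → S i j ≡ true → M i j ≡ M' i j
  agree-on-covered {M = M} {M'} ((M-sym , _) , _) ((M'-sym , _) , _) W-covers agree i j Sij
    with W-covers i j Sij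
  ... | inj₁ Wi = agree i Wi j
  ... | inj₂ Wj = begin
    M i j   ≡⟨ M-sym i j ⟩
    M j i   ≡⟨ agree j Wj i ⟩
    M' j i  ≡⟨ M'-sym j i ⟩
    M' i j  ∎
    where open ≡-Reasoning

  leftEnds-covers : {S : EdgeSet n} → IsEdgeSet G S → Covers (leftEnds S) S
  leftEnds-covers {S} (S-sym , S⊆G) i j Sij with <ᵇ-trichotomy i j
  ... | inj₁ i<j         = inj₁ (leftEnds-true S i<j Sij)
  ... | inj₂ (inj₁ j<i)  = inj₂ (leftEnds-true S j<i (trans (S-sym j i) Sij))
  ... | inj₂ (inj₂ refl) = ⊥-elim (true≢false (trans (sym (S⊆G i i Sij)) (irrefl G i)))

  touching-isEdgeSet : {E : EdgeSet n} (W : Fin n → Bool) → IsEdgeSet G E →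
    IsEdgeSet G (touching E W)
  touching-isEdgeSet W (E-sym , E⊆G) = touching-symmetric W E-sym , (λ i j → E⊆G i j ∘ ∧-trueˡ)

  ∖-isEdgeSet : {M : EdgeSet n} → IsEdgeSet G M → IsEdgeSet G (adj G ∖ M)
  ∖-isEdgeSet (M-sym , _) = (λ i j → cong₂ _∧_ (Graph.sym G i j) (cong not (M-sym i j))) , (λ i j → ∧-trueˡ)

  touching-isForcingSet : {M S : EdgeSet n} {W : Fin n → Bool} → IsPM G M →
    IsGlobalForcingSet G S → Covers W S → IsForcingSet G M (touching M W)
  touching-isForcingSet {M} {S} {W} M-pm@(M-edges , partner) (_ , S-global) W-covers =
    touching-isEdgeSet W M-edges , (λ i j → ∧-trueˡ) , forced
    where
    forced : ∀ M' → IsPM G M' → touching M W ⊆E M' → M' ≈E M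
    forced M' M'-pm T⊆M' = S-global M' M M'-pm M-pm sameOnS
      where
      agreeOnW : ∀ i → W i ≡ true → AgreeAt M M' i
      agreeOnW i Wi with partner i
      ... | k , Mik , _ = agreeAt-sharedEdge M-pm M'-pm Mik
                            (T⊆M' i k (cong₂ (λ a b → a ∧ (b ∨ W k)) Mik Wi))
      sameOnS : ∀ i j → S i j ∧ M' i j ≡ S i j ∧ M i j
      sameOnS i j with S i j in Sij
      ... | false = refl
      ... | true  = sym (agree-on-covered M-pm M'-pm W-covers agreeOnW i j Sij)

  touching-∖-isAntiForcingSet : {M T : EdgeSet n} {W : Fin n → Bool} → IsPM G M →
    IsForcingSet G M T → Covers W T → IsAntiForcingSet G M (touching (adj G ∖ M) W)
  touching-∖-isAntiForcingSet {M} {T} {W} M-pm@(M-edges , _) (_ , T⊆M , T-forcing) W-covers =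
    touching-isEdgeSet W (∖-isEdgeSet M-edges) , disjoint , forced
    where
    A : EdgeSet n
    A = touching (adj G ∖ M) W
    disjoint : Disjoint A M
    disjoint i j with M i j
    ... | false = ∧-zeroʳ _
    ... | true rewrite ∧-zeroʳ (adj G i j) = refl
    forced : ∀ M' → IsPM G M' → Disjoint A M' → M' ≈E M
    forced M' M'-pm@((_ , M'⊆G) , partner') A∩M'≡∅ = T-forcing M' M'-pm T⊆M'
      where
      M'⊆M-at-W : ∀ {i k} → W i ≡ true → M' i k ≡ true → M i k ≡ true
      M'⊆M-at-W {i} {k} Wi M'ik with M i k in Mik
      ... | true  = refl
      ... | false = ⊥-elim (true≢false (trans (sym A∧M'≡true) (A∩M'≡∅ i k)))
        where
        A∧M'≡true : A i k ∧ M' i k ≡ true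
        A∧M'≡true rewrite M'⊆G i k M'ik | Mik | Wi | M'ik = refl
      agreeOnW : ∀ i → W i ≡ true → AgreeAt M M' i
      agreeOnW i Wi with partner' i
      ... | k , M'ik , _ = agreeAt-sharedEdge M-pm M'-pm (M'⊆M-at-W Wi M'ik) M'ik
      T⊆M' : T ⊆E M'
      T⊆M' i j Tij = trans (sym (agree-on-covered M-pm M'-pm W-covers agreeOnW i j Tij)) (T⊆M i j Tij)

  forcingNumber≤size-globalForcingSet : {M S : EdgeSet n} {f : ℕ} → IsPM G M →
    IsGlobalForcingSet G S → IsForcingNumber G M f → f ≤ size S
  forcingNumber≤size-globalForcingSet {M} {S} {f} M-pm@((M-sym , _) , _) S-global (_ , f-min) = begin
    f                          ≤⟨ f-min (size T) (T , T-forcing , refl) ⟩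
    size T                     ≤⟨ size-touching≤ M (leftEnds S) M-sym (ℕ.≤-reflexive ∘ degreeIn-pm M-pm) ⟩
    1 · count (leftEnds S)     ≡⟨ ℕ.*-identityˡ _ ⟩
    count (leftEnds S)         ≤⟨ count-leftEnds≤size S ⟩
    size S                     ∎
    where
    open ℕ.≤-Reasoning
    T : EdgeSet n
    T = touching M (leftEnds S)
    T-forcing : IsForcingSet G M T
    T-forcing = touching-isForcingSet M-pm S-global (leftEnds-covers (proj₁ S-global))

  antiForcingNumber≤size-forcingSet : {M T : EdgeSet n} {a : ℕ} → IsPM G M →
    IsForcingSet G M T → IsAntiForcingNumber G M a → a ≤ (maxDegree G ∸ 1) · size T
  antiForcingNumber≤size-forcingSet {M} {T} {a} M-pm@(M-edges , _) T-forcing (_ , a-min) = begin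
    a                                        ≤⟨ a-min (size A) (A , A-antiForcing , refl) ⟩
    size A                                   ≤⟨ size-touching≤ (adj G ∖ M) (leftEnds T)
                                                  (proj₁ (∖-isEdgeSet M-edges)) (degreeIn-∖-pm M-pm) ⟩
    (maxDegree G ∸ 1) · count (leftEnds T)   ≤⟨ ℕ.*-monoʳ-≤ (maxDegree G ∸ 1) (count-leftEnds≤size T) ⟩
    (maxDegree G ∸ 1) · size T               ∎
    where
    open ℕ.≤-Reasoning
    A : EdgeSet n
    A = touching (adj G ∖ M) (leftEnds T)
    A-antiForcing : IsAntiForcingSet G M A
    A-antiForcing = touching-∖-isAntiForcingSet M-pm T-forcing (leftEnds-covers (proj₁ T-forcing))

¬¬-minimum : (P : ℕ → Set) {k : ℕ} → P k → ¬ ¬ ∃ (IsMin P)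
¬¬-minimum P {k} = <-rec (λ k → P k → ¬ ¬ ∃ (IsMin P)) step k
  where
  step : ∀ k → (∀ {j} → j < k → P j → ¬ ¬ ∃ (IsMin P)) → P k → ¬ ¬ ∃ (IsMin P)
  step k below Pk ¬min = ¬min (k , Pk , λ m Pm → ℕ.≮⇒≥ (λ m<k → below m<k Pm ¬min))

gap-bound : ∀ {gf Af F Δ} → F ≤ gf → Af ≤ (Δ ∸ 1) · F → (Δ ≡ 0 → gf ≡ 0) →
  (+ gf) - (+ Af) ≥ ((+ 2) - (+ Δ)) * (+ F)
gap-bound {gf} {Af} {F} {zero} F≤gf Af≤0 gf≡0
  rewrite gf≡0 refl | ℕ.n≤0⇒n≡0 F≤gf | ℕ.n≤0⇒n≡0 Af≤0 = ℤ.≤-refl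
gap-bound {gf} {Af} {F} {suc d} F≤gf Af≤dF _ = begin
  ((+ 2) - (+ suc d)) * (+ F)  ≡⟨ [2-[1+d]]F≡F-dF (+ d) (+ F) ⟩
  (+ F) - (+ d) * (+ F)        ≡⟨ cong ((+ F) -_) (sym (ℤ.pos-* d F)) ⟩
  (+ F) - (+ (d · F))          ≤⟨ ℤ.+-mono-≤ (ℤ.+≤+ F≤gf) (ℤ.neg-mono-≤ (ℤ.+≤+ Af≤dF)) ⟩
  (+ gf) - (+ Af)              ∎
  where
  open ℤ.≤-Reasoning
  [2-[1+d]]F≡F-dF : ∀ (d F : ℤ) → ((+ 2) - ((+ 1) ℤ.+ d)) * F ≡ F - d * F
  [2-[1+d]]F≡F-dF = solve 2 (λ d F → (con (+ 2) :- (con (+ 1) :+ d)) :* F := F :- d :* F) refl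
    where open +-*-Solver

-- The forcing number of M₀ is a minimum over all edge sets, so it exists only under double
-- negation; the goal is a decidable integer inequality, which makes that enough.
corollary2p9 : ∀ {n} (G : Graph n) → HasPM G →
    ∀ (gf Af F : ℕ) → IsGlobalForcingNumber G gf → IsMaxAntiForcingNumber G Af →
    IsMaxForcingNumber G F →
    (+ gf) - (+ Af) ≥ ((+ 2) - (+ maxDegree G)) * (+ F)
corollary2p9 G _ .(size S) Af F ((S , S-global , refl) , _)
             ((M₀ , M₀-pm , Af-M₀) , _) ((M₁ , M₁-pm , F-M₁) , F-max) =
  decidable-stable (_ ℤ.≤? _) λ ¬goal →
    ¬¬-minimum _ (T₀ , T₀-forcing , refl) λ f-M₀ →
      ¬goal (gap-bound F≤gf (Af≤[Δ∸1]F f-M₀) (maxDegree≡0⇒size≡0 G (proj₁ S-global)))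
  where
  F≤gf : F ≤ size S
  F≤gf = forcingNumber≤size-globalForcingSet G M₁-pm S-global F-M₁
  T₀ : EdgeSet _
  T₀ = touching M₀ (leftEnds S)
  T₀-forcing : IsForcingSet G M₀ T₀
  T₀-forcing = touching-isForcingSet G M₀-pm S-global (leftEnds-covers G (proj₁ S-global))
  Af≤[Δ∸1]F : ∃ (IsForcingNumber G M₀) → Af ≤ (maxDegree G ∸ 1) · F
  Af≤[Δ∸1]F (_ , f-M₀@((T , T-forcing , refl) , _)) =
    ℕ.≤-trans (antiForcingNumber≤size-forcingSet G M₀-pm T-forcing Af-M₀)
              (ℕ.*-monoʳ-≤ (maxDegree G ∸ 1) (F-max (size T) (M₀ , M₀-pm , f-M₀)))
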